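{- Let $H$ be a simple hypergraph having no odd exact cycle. Then the characteristic polynomial of the unified signless Laplacian matrix $\mathbf U^{\mathbf Q}(H)$ coincides with the characteristic polynomial of the unified Laplacian matrix $\mathbf U^{\mathbf L}(H)$.
   Context: A hypergraph $H$ consists of a nonempty finite vertex set $V(H)$ and a finite multiset $E(H)$ of nonempty subsets of $V(H)$ (edges); $H$ is simple if it has no edges of cardinality $1$ and no repeated edges. A 2-partition of a set $e$ is an unordered pair $\{S_1,S_2\}$ of nonempty disjoint sets with union $e$. $I(H)$ is the set of all parts of all 2-partitions of all edges of $H$, together with all singletons $\{v\}$, $v\in V(H)$. For $S,S'\in I(H)$ write $S\sim S'$ if $\{S,S'\}$ is a 2-partition of some edge. For simple $H$, $d^*_H(S)$ is the number of $S'\in I(H)$ with $S\sim S'$; the unified matrix $\mathbf U(H)$ is the $0$-$1$ matrix indexed by $I(H)$ with $(S,S')$ entry $1$ iff $S\sim S'$; $\mathbf U^{\mathbf L}(H)=\mathrm{diag}(d^*_H(S))-\mathbf U(H)$ and $\mathbf U^{\mathbf Q}(H)=\mathrm{diag}(d^*_H(S))+\mathbf U(H)$. An exact walk is a sequence $S_0,e_1,S_1,\dots,e_n,S_n$ with $e_i\in E(H)$ and $\{S_{i-1},S_i\}$ a 2-partition of $e_i$; its length is $n$. An exact cycle is an exact walk with at least three distinct edges, $S_0=S_n$, and distinct internal parts $S_1,\dots,S_{n-1}$; it is odd if its length is odd. -}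

module Defs where

open import Data.Nat as ℕ using (ℕ; zero; suc)
open import Data.Integer as ℤ using (ℤ; +_; -_)
open import Data.Bool using (Bool; true; false; if_then_else_)
open import Data.Bool.Properties using () renaming (_≟_ to _≟ᵇ_)
open import Data.Fin using (Fin; zero; suc; toℕ; inject₁; punchIn) renaming (_≟_ to _≟ᶠ_)
open import Data.Fin.Subset using (Subset; Nonempty; _∩_; _∪_; ⊥; ⁅_⁆; ∣_∣)
open import Data.Fin.Subset.Properties using (nonempty?)
open import Data.Vec.Properties using (≡-dec)
open import Data.List using (List; []; _∷_; map)
open import Data.List.Membership.Propositional using (_∈_)
open import Data.List.Relation.Unary.Any using (Any; any?)
open import Data.List.Relation.Unary.All using (All)
open import Data.List.Relation.Unary.Unique.Propositional using (Unique)
open import Data.Product using (Σ; ∃; ∃-syntax; _×_; _,_)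
open import Data.Sum using (_⊎_)
open import Relation.Binary.PropositionalEquality using (_≡_; _≢_)
open import Relation.Nullary using (Dec; yes; no; ¬_)
open import Relation.Nullary.Decidable using (_×-dec_; ⌊_⌋)
open import Function.Definitions using (Injective)

-- Hypergraphs on the vertex set Fin (suc k) (nonempty vertex set);
-- the edge multiset is a list of subsets.

record Hypergraph : Set where
  field
    k     : ℕ
    edges : List (Subset (suc k))
open Hypergraph public

V : Hypergraph → Set
V H = Fin (suc (k H))

Sub : Hypergraph → Set
Sub H = Subset (suc (k H))

WellFormed : Hypergraph → Set
WellFormed H = All Nonempty (edges H)

Simple : Hypergraph → Set
Simple H = All (λ e → ∣ e ∣ ≢ 1) (edges H) × Unique (edges H)

TwoPartition : {n : ℕ} → Subset n → Subset n → Subset n → Set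
TwoPartition e S S' = Nonempty S × Nonempty S' × (S ∩ S' ≡ ⊥) × (S ∪ S' ≡ e)

twoPartition? : {n : ℕ} (e S S' : Subset n) → Dec (TwoPartition e S S')
twoPartition? e S S' =
  nonempty? S ×-dec (nonempty? S' ×-dec (≡-dec _≟ᵇ_ (S ∩ S') ⊥ ×-dec ≡-dec _≟ᵇ_ (S ∪ S') e))

Sim : (H : Hypergraph) → Sub H → Sub H → Set
Sim H S S' = Any (λ e → TwoPartition e S S') (edges H)

sim? : (H : Hypergraph) (S S' : Sub H) → Dec (Sim H S S')
sim? H S S' = any? (λ e → twoPartition? e S S') (edges H)

InI : (H : Hypergraph) → Sub H → Set
InI H S = (∃[ e ] (e ∈ edges H × ∃[ S' ] TwoPartition e S S'))
        ⊎ (∃[ v ] S ≡ ⁅ v ⁆)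

record Enumeration (H : Hypergraph) : Set where
  field
    m        : ℕ
    elt      : Fin m → Sub H
    injective : Injective _≡_ _≡_ elt
    sound    : ∀ i → InI H (elt i)
    complete : ∀ S → InI H S → ∃[ i ] elt i ≡ S
open Enumeration public

record ExactWalk (H : Hypergraph) : Set where
  field
    len   : ℕ
    part  : Fin (suc len) → Sub H
    edge  : Fin len → Sub H                -- e_1 , ... , e_len  (edge i = e_{i+1})
    edge∈ : ∀ i → edge i ∈ edges H
    step  : ∀ i → TwoPartition (edge i) (part (inject₁ i)) (part (suc i))
open ExactWalk public

data Odd : ℕ → Set where
  odd-one : Odd 1
  odd-ss  : ∀ {n} → Odd n → Odd (suc (suc n))

IsExactCycle : {H : Hypergraph} → ExactWalk H → Set
IsExactCycle {H} W =
  (∃[ a ] ∃[ b ] ∃[ c ] (edge W a ≢ edge W b × edge W a ≢ edge W c × edge W b ≢ edge W c))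
  × part W zero ≡ part W (Data.Fin.fromℕ (len W))
  × (∀ (i j : Fin (suc (len W))) →
       0 ℕ.< toℕ i → toℕ i ℕ.< len W →
       0 ℕ.< toℕ j → toℕ j ℕ.< len W →
       part W i ≡ part W j → i ≡ j)

HasOddExactCycle : Hypergraph → Set
HasOddExactCycle H = ∃[ W ] (IsExactCycle {H} W × Odd (len W))

-- Polynomials over ℤ as coefficient lists (index = degree)

Poly : Set
Poly = List ℤ

coeff : Poly → ℕ → ℤ
coeff []       _       = + 0
coeff (a ∷ p)  zero    = a
coeff (a ∷ p)  (suc i) = coeff p i

_≈ₚ_ : Poly → Poly → Set
p ≈ₚ q = ∀ i → coeff p i ≡ coeff q i

_⊕_ : Poly → Poly → Poly
[]      ⊕ q       = q
(a ∷ p) ⊕ []      = a ∷ p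
(a ∷ p) ⊕ (b ∷ q) = (a ℤ.+ b) ∷ (p ⊕ q)

scale : ℤ → Poly → Poly
scale c = map (c ℤ.*_)

_⊛_ : Poly → Poly → Poly
[]      ⊛ q = []
(a ∷ p) ⊛ q = scale a q ⊕ (+ 0 ∷ (p ⊛ q))

Matrix : Set → ℕ → Set
Matrix A m = Fin m → Fin m → A

sumPoly : {m : ℕ} → (Fin m → Poly) → Poly
sumPoly {zero}  f = []
sumPoly {suc m} f = f zero ⊕ sumPoly (λ j → f (suc j))

sign : ℕ → ℤ
sign zero          = + 1
sign (suc zero)    = - (+ 1)
sign (suc (suc n)) = sign n

minor : {m : ℕ} → Matrix Poly (suc m) → Fin (suc m) → Matrix Poly m
minor M j r c = M (suc r) (punchIn j c)

detPoly : {m : ℕ} → Matrix Poly m → Poly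
detPoly {zero}  M = + 1 ∷ []
detPoly {suc m} M =
  sumPoly (λ j → scale (sign (toℕ j)) (M zero j ⊛ detPoly (minor M j)))

charPoly : {m : ℕ} → Matrix ℤ m → Poly
charPoly M = detPoly (λ i j → if ⌊ i ≟ᶠ j ⌋
                                 then (- M i j) ∷ + 1 ∷ []
                                 else (- M i j) ∷ [])

sumℤ : {m : ℕ} → (Fin m → ℤ) → ℤ
sumℤ {zero}  f = + 0
sumℤ {suc m} f = f zero ℤ.+ sumℤ (λ j → f (suc j))

U : (H : Hypergraph) (ε : Enumeration H) → Matrix ℤ (m ε)
U H ε i j = if ⌊ sim? H (elt ε i) (elt ε j) ⌋ then + 1 else + 0

dstar : (H : Hypergraph) (ε : Enumeration H) → Fin (m ε) → ℤ
dstar H ε i = sumℤ (U H ε i)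

diagM : {m : ℕ} → (Fin m → ℤ) → Matrix ℤ m
diagM d i j = if ⌊ i ≟ᶠ j ⌋ then d i else + 0

UL : (H : Hypergraph) (ε : Enumeration H) → Matrix ℤ (m ε)
UL H ε i j = diagM (dstar H ε) i j ℤ.- U H ε i j

UQ : (H : Hypergraph) (ε : Enumeration H) → Matrix ℤ (m ε)
UQ H ε i j = diagM (dstar H ε) i j ℤ.+ U H ε i j

{-# OPTIONS --safe #-}
module Submission where

-- The relation ∼ is symmetric and irreflexive, i.e. a graph on I(H).  A shortest closed walk of odd length in this graph
-- visits no vertex twice; it cannot alternate between just two edges (its length is odd) and
-- consecutive edges differ (else the walk would backtrack), so it is an odd exact cycle.  Hence the
-- graph has no odd closed walk and is bipartite: a colour c with values in {0, 1} gives opposite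
-- colours to S ∼ S′.  With D = diag((-1)^c) we get D U D = -U while D commutes with the degree
-- matrix, so x I - U^Q = D (x I - U^L) D, and det D² = 1.
--
-- Reachability in the graph is not decided constructively, so the colouring is only obtained
-- under double negation; the conclusion, an equation between integers, is stable under it.

open import Defs

open import Level using (_⊔_)
open import Function using (_∘_)
open import Data.Empty using (⊥-elim)
open import Data.Product using (∃; ∃₂; ∃-syntax; _×_; _,_; proj₁; proj₂)
open import Data.Sum using (_⊎_; inj₁; inj₂; [_,_]′)
open import Data.Bool using (if_then_else_)
import Data.Bool.Properties as Boolₚ
open import Data.Nat using (ℕ; zero; suc; pred; _+_; _∸_; _<_; _≤_; z≤n; s≤s; parity)
import Data.Nat.Properties as ℕₚ
open import Data.Nat.Induction using (<-wellFounded)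
open import Induction.WellFounded using (Acc; acc)
open import Data.Parity.Base as ℙ using (Parity; 0ℙ; 1ℙ; _⁻¹)
import Data.Parity.Properties as ℙₚ
open import Data.Integer as ℤ using (ℤ; +_; -_; _*_; 0ℤ; 1ℤ; -1ℤ)
import Data.Integer.Properties as ℤₚ
open import Data.Fin as Fin using (Fin; zero; suc; toℕ; fromℕ; punchIn) renaming (_≟_ to _≟ᶠ_)
import Data.Fin.Properties as Finₚ
open import Data.Fin.Subset using (Subset; _∩_; _∪_) renaming (⊥ to ∅; _∈_ to _∈ₛ_)
import Data.Fin.Subset.Properties as Subsetₚ
open import Data.Vec.Functional using (removeAt)
open import Data.Vec.Properties using (≡-dec)
open import Data.List using ([]; _∷_)
import Data.List.Properties as Listₚ
open import Data.List.Membership.Propositional using (_∈_; find)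
import Data.List.Relation.Unary.Any as Any
open import Relation.Binary using (Rel; Symmetric; DecidableEquality; tri<; tri≈; tri>)
open import Relation.Binary.PropositionalEquality
open import Relation.Nullary using (¬_; Dec; yes; no; ¬?)
open import Relation.Nullary.Decidable using (⌊_⌋; decidable-stable; _×-dec_; ¬¬-excluded-middle)
open import Relation.Nullary.Negation using (¬¬-map; contradiction)
open import Relation.Unary using (Pred; Decidable)

open import Algebra.Properties.CommutativeMonoid.Sum ℤₚ.*-1-commutativeMonoid
  using (sum-remove; ∑-distrib-+; sum-cong-≗; sum-replicate-zero) renaming (sum to ∏)
open import Algebra.Properties.CommutativeSemigroup ℤₚ.*-commutativeSemigroup using (interchange)

open ≡-Reasoning

scale-⊕ : ∀ c p q → scale c (p ⊕ q) ≡ scale c p ⊕ scale c q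
scale-⊕ c []      q       = refl
scale-⊕ c (a ∷ p) []      = refl
scale-⊕ c (a ∷ p) (b ∷ q) = cong₂ _∷_ (ℤₚ.*-distribˡ-+ c a b) (scale-⊕ c p q)

scale-scale : ∀ c d p → scale c (scale d p) ≡ scale (c * d) p
scale-scale c d p = trans (sym (Listₚ.map-∘ p)) (Listₚ.map-cong (λ a → sym (ℤₚ.*-assoc c d a)) p)

scale-1 : ∀ p → scale 1ℤ p ≡ p
scale-1 p = trans (Listₚ.map-cong ℤₚ.*-identityˡ p) (Listₚ.map-id p)

scale-comm : ∀ c d p → scale c (scale d p) ≡ scale d (scale c p)
scale-comm c d p = begin
  scale c (scale d p) ≡⟨ scale-scale c d p ⟩
  scale (c * d) p     ≡⟨ cong (λ e → scale e p) (ℤₚ.*-comm c d) ⟩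
  scale (d * c) p     ≡⟨ scale-scale d c p ⟨
  scale d (scale c p) ∎

scale-⊕-shift : ∀ c p q → scale c p ⊕ (0ℤ ∷ scale c q) ≡ scale c (p ⊕ (0ℤ ∷ q))
scale-⊕-shift c p q = begin
  scale c p ⊕ (0ℤ ∷ scale c q)  ≡⟨ cong (λ z → scale c p ⊕ (z ∷ scale c q)) (ℤₚ.*-zeroʳ c) ⟨
  scale c p ⊕ scale c (0ℤ ∷ q)  ≡⟨ scale-⊕ c p (0ℤ ∷ q) ⟨
  scale c (p ⊕ (0ℤ ∷ q))        ∎

scale-⊛ˡ : ∀ c p q → scale c p ⊛ q ≡ scale c (p ⊛ q)
scale-⊛ˡ c []      q = refl
scale-⊛ˡ c (a ∷ p) q = begin
  scale (c * a) q ⊕ (0ℤ ∷ scale c p ⊛ q)        ≡⟨ cong₂ (λ u v → u ⊕ (0ℤ ∷ v)) (sym (scale-scale c a q)) (scale-⊛ˡ c p q) ⟩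
  scale c (scale a q) ⊕ (0ℤ ∷ scale c (p ⊛ q))  ≡⟨ scale-⊕-shift c (scale a q) (p ⊛ q) ⟩
  scale c (scale a q ⊕ (0ℤ ∷ p ⊛ q))            ∎

scale-⊛ʳ : ∀ c p q → p ⊛ scale c q ≡ scale c (p ⊛ q)
scale-⊛ʳ c []      q = refl
scale-⊛ʳ c (a ∷ p) q = begin
  scale a (scale c q) ⊕ (0ℤ ∷ p ⊛ scale c q)    ≡⟨ cong₂ (λ u v → u ⊕ (0ℤ ∷ v)) (scale-comm a c q) (scale-⊛ʳ c p q) ⟩
  scale c (scale a q) ⊕ (0ℤ ∷ scale c (p ⊛ q))  ≡⟨ scale-⊕-shift c (scale a q) (p ⊛ q) ⟩
  scale c (scale a q ⊕ (0ℤ ∷ p ⊛ q))            ∎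

scale-⊛-scale : ∀ c d p q → scale c p ⊛ scale d q ≡ scale (c * d) (p ⊛ q)
scale-⊛-scale c d p q = begin
  scale c p ⊛ scale d q      ≡⟨ scale-⊛ˡ c p (scale d q) ⟩
  scale c (p ⊛ scale d q)    ≡⟨ cong (scale c) (scale-⊛ʳ d p q) ⟩
  scale c (scale d (p ⊛ q))  ≡⟨ scale-scale c d (p ⊛ q) ⟩
  scale (c * d) (p ⊛ q)      ∎

sumPoly-cong : ∀ {n} {f g : Fin n → Poly} → (∀ j → f j ≡ g j) → sumPoly f ≡ sumPoly g
sumPoly-cong {zero}  f≗g = refl
sumPoly-cong {suc n} f≗g = cong₂ _⊕_ (f≗g zero) (sumPoly-cong (f≗g ∘ suc))

sumPoly-scale : ∀ {n} c (f : Fin n → Poly) → sumPoly (λ j → scale c (f j)) ≡ scale c (sumPoly f)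
sumPoly-scale {zero}  c f = refl
sumPoly-scale {suc n} c f = trans (cong (scale c (f zero) ⊕_) (sumPoly-scale c (f ∘ suc)))
                                  (sym (scale-⊕ c (f zero) (sumPoly (f ∘ suc))))

laplaceTerm : ∀ {n} → Matrix Poly (suc n) → Fin (suc n) → Poly
laplaceTerm M j = scale (sign (toℕ j)) (M zero j ⊛ detPoly (minor M j))

detPoly-cong : ∀ {n} {M N : Matrix Poly n} → (∀ i j → M i j ≡ N i j) → detPoly M ≡ detPoly N
detPoly-cong {zero}  M≡N = refl
detPoly-cong {suc n} M≡N = sumPoly-cong λ j →
  cong₂ (λ u v → scale (sign (toℕ j)) (u ⊛ v)) (M≡N zero j) (detPoly-cong λ r c → M≡N (suc r) (punchIn j c))

scaleMatrix : ∀ {n} → (Fin n → ℤ) → (Fin n → ℤ) → Matrix Poly n → Matrix Poly n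
scaleMatrix a b M i j = scale (a i * b j) (M i j)

detPoly-scaleMatrix : ∀ {n} (a b : Fin n → ℤ) (M : Matrix Poly n) →
                      detPoly (scaleMatrix a b M) ≡ scale (∏ a * ∏ b) (detPoly M)
detPoly-scaleMatrix {zero}  a b M = refl
detPoly-scaleMatrix {suc n} a b M =
  trans (sumPoly-cong expand) (sumPoly-scale (∏ a * ∏ b) (laplaceTerm M))
  where
  expand : ∀ j → laplaceTerm (scaleMatrix a b M) j ≡ scale (∏ a * ∏ b) (laplaceTerm M j)
  expand j = begin
    scale σ (scale (a zero * b j) x ⊛ detPoly (scaleMatrix (a ∘ suc) (removeAt b j) (minor M j)))
      ≡⟨ cong (λ y → scale σ (scale (a zero * b j) x ⊛ y)) (detPoly-scaleMatrix (a ∘ suc) (removeAt b j) (minor M j)) ⟩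
    scale σ (scale (a zero * b j) x ⊛ scale (∏ (a ∘ suc) * ∏ (removeAt b j)) d)
      ≡⟨ cong (scale σ) (scale-⊛-scale (a zero * b j) (∏ (a ∘ suc) * ∏ (removeAt b j)) x d) ⟩
    scale σ (scale ((a zero * b j) * (∏ (a ∘ suc) * ∏ (removeAt b j))) (x ⊛ d))
      ≡⟨ cong (λ e → scale σ (scale e (x ⊛ d))) coefficient ⟩
    scale σ (scale (∏ a * ∏ b) (x ⊛ d))
      ≡⟨ scale-comm σ (∏ a * ∏ b) (x ⊛ d) ⟩
    scale (∏ a * ∏ b) (scale σ (x ⊛ d)) ∎
    where
    σ : ℤ
    σ = sign (toℕ j)
    x d : Poly
    x = M zero j
    d = detPoly (minor M j)
    coefficient : (a zero * b j) * (∏ (a ∘ suc) * ∏ (removeAt b j)) ≡ ∏ a * ∏ b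
    coefficient = trans (interchange (a zero) (b j) (∏ (a ∘ suc)) (∏ (removeAt b j)))
                        (cong (∏ a *_) (sym (sum-remove {i = j} b)))

∏-square≡1 : ∀ {n} (s : Fin n → ℤ) → (∀ i → s i * s i ≡ 1ℤ) → ∏ s * ∏ s ≡ 1ℤ
∏-square≡1 {n} s s²≡1 = begin
  ∏ s * ∏ s            ≡⟨ ∑-distrib-+ s s ⟨
  ∏ (λ i → s i * s i)  ≡⟨ sum-cong-≗ s²≡1 ⟩
  ∏ {n} (λ _ → 1ℤ)     ≡⟨ sum-replicate-zero n ⟩
  1ℤ                   ∎

charMatrix : ∀ {n} → Matrix ℤ n → Matrix Poly n
charMatrix M i j = if ⌊ i ≟ᶠ j ⌋ then (- M i j) ∷ + 1 ∷ [] else (- M i j) ∷ []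

charPoly-signConjugate : ∀ {n} (M N : Matrix ℤ n) (s : Fin n → ℤ) → (∀ i → s i * s i ≡ 1ℤ) →
                         (∀ i j → M i j ≡ s i * s j * N i j) → charPoly M ≡ charPoly N
charPoly-signConjugate M N s s²≡1 M≡sNs = begin
  detPoly (charMatrix M)                       ≡⟨ detPoly-cong entry ⟩
  detPoly (scaleMatrix s s (charMatrix N))     ≡⟨ detPoly-scaleMatrix s s (charMatrix N) ⟩
  scale (∏ s * ∏ s) (detPoly (charMatrix N))   ≡⟨ cong (λ c → scale c (detPoly (charMatrix N))) (∏-square≡1 s s²≡1) ⟩
  scale 1ℤ (detPoly (charMatrix N))            ≡⟨ scale-1 (detPoly (charMatrix N)) ⟩
  detPoly (charMatrix N)                       ∎
  where
  entry : ∀ i j → charMatrix M i j ≡ scaleMatrix s s (charMatrix N) i j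
  entry i j with i ≟ᶠ j
  ... | no _     = cong (_∷ []) (trans (cong -_ (M≡sNs i j)) (ℤₚ.neg-distribʳ-* (s i * s j) (N i j)))
  ... | yes refl = begin
    (- M i i) ∷ + 1 ∷ []                      ≡⟨ cong (λ z → - z ∷ + 1 ∷ []) diagonal ⟩
    (- N i i) ∷ + 1 ∷ []                      ≡⟨ scale-1 _ ⟨
    scale 1ℤ ((- N i i) ∷ + 1 ∷ [])           ≡⟨ cong (λ c → scale c ((- N i i) ∷ + 1 ∷ [])) (s²≡1 i) ⟨
    scale (s i * s i) ((- N i i) ∷ + 1 ∷ [])  ∎
    where
    diagonal : M i i ≡ N i i
    diagonal = trans (M≡sNs i i) (trans (cong (_* N i i) (s²≡1 i)) (ℤₚ.*-identityˡ (N i i)))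

least : ∀ {n p} {P : Pred (Fin n) p} → Decidable P → ∃ P → ∃ P
least {suc n} P? (i , pi) with P? zero
least {suc n} P? (i     , pi) | yes p0 = zero , p0
least {suc n} P? (zero  , pi) | no ¬p0 = contradiction pi ¬p0
least {suc n} P? (suc i , pi) | no ¬p0 = let j , pj = least (P? ∘ suc) (i , pi) in suc j , pj

least-cong : ∀ {n p q} {P : Pred (Fin n) p} {Q : Pred (Fin n) q} (P? : Decidable P) (Q? : Decidable Q)
             (x : ∃ P) (y : ∃ Q) → (∀ i → P i → Q i) → (∀ i → Q i → P i) →
             proj₁ (least P? x) ≡ proj₁ (least Q? y)
least-cong {suc n} P? Q? (i , pi) (j , qj) P⇒Q Q⇒P with P? zero | Q? zero
... | yes _  | yes _  = refl
... | yes p0 | no ¬q0 = contradiction (P⇒Q zero p0) ¬q0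
... | no ¬p0 | yes q0 = contradiction (Q⇒P zero q0) ¬p0
least-cong P? Q? (zero  , pi) _            _   _   | no ¬p0 | no _   = contradiction pi ¬p0
least-cong P? Q? (suc _ , _)  (zero , qj)  _   _   | no _   | no ¬q0 = contradiction qj ¬q0
least-cong P? Q? (suc i , pi) (suc j , qj) P⇒Q Q⇒P | no _   | no _   =
  cong suc (least-cong (P? ∘ suc) (Q? ∘ suc) (i , pi) (j , qj) (P⇒Q ∘ suc) (Q⇒P ∘ suc))

¬¬-∀ : ∀ {n p} {P : Pred (Fin n) p} → (∀ i → ¬ ¬ P i) → ¬ ¬ (∀ i → P i)
¬¬-∀ {zero}  _   ¬∀ = ¬∀ λ ()
¬¬-∀ {suc n} ¬¬P ¬∀ = ¬¬P zero λ p0 → ¬¬-∀ (¬¬P ∘ suc) λ ps → ¬∀ (Finₚ.∀-cons p0 ps)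

parity-+-odd : ∀ a b → parity (a + b) ≡ 1ℙ → parity a ≡ 1ℙ ⊎ parity b ≡ 1ℙ
parity-+-odd a b odd with parity a | ℙₚ.+-homo-+ a b
... | 0ℙ | a+b≡b = inj₂ (trans (sym a+b≡b) odd)
... | 1ℙ | _     = inj₁ refl

parity-+-suc : ∀ a b → parity a ≡ parity b → parity (a + suc b) ≡ 1ℙ
parity-+-suc a b a≡b = begin
  parity (a + suc b)           ≡⟨ ℙₚ.+-homo-+ a (suc b) ⟩
  parity a ℙ.+ parity (suc b)  ≡⟨ cong₂ ℙ._+_ a≡b (sym (ℙₚ.⁻¹-selfInverse (ℙₚ.suc-homo-⁻¹ b))) ⟩
  parity b ℙ.+ parity b ⁻¹     ≡⟨ ℙₚ.p+p⁻¹≡1ℙ (parity b) ⟩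
  1ℙ                           ∎

parity-pred : ∀ n → parity (suc n) ≡ 1ℙ → parity n ≡ 0ℙ
parity-pred n odd = trans (sym (ℙₚ.suc-homo-⁻¹ n)) (cong _⁻¹ odd)

parity⇒Odd : ∀ n → parity n ≡ 1ℙ → Odd n
parity⇒Odd 1             _   = odd-one
parity⇒Odd (suc (suc n)) odd = odd-ss (parity⇒Odd n odd)

module _ {b} {B : Set b} where

  twoValued-alternates : ∀ {u v x y z : B} → x ≡ u ⊎ x ≡ v → y ≡ u ⊎ y ≡ v → z ≡ u ⊎ z ≡ v →
                         x ≢ y → y ≢ z → x ≡ z
  twoValued-alternates (inj₁ refl) (inj₁ refl) _           x≢y _   = contradiction refl x≢y
  twoValued-alternates (inj₂ refl) (inj₂ refl) _           x≢y _   = contradiction refl x≢y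
  twoValued-alternates _           (inj₁ refl) (inj₁ refl) _   y≢z = contradiction refl y≢z
  twoValued-alternates _           (inj₂ refl) (inj₂ refl) _   y≢z = contradiction refl y≢z
  twoValued-alternates (inj₁ refl) (inj₂ refl) (inj₁ refl) _   _   = refl
  twoValued-alternates (inj₂ refl) (inj₁ refl) (inj₂ refl) _   _   = refl

  -- f is read cyclically: f (pred n) is followed by f 0.
  oddCycle-thirdValue : DecidableEquality B → ∀ {n} (f : ℕ → B) → parity n ≡ 1ℙ →
                        (∀ {i} → suc i < n → f i ≢ f (suc i)) → f (pred n) ≢ f 0 →
                        ∃ λ (c : Fin n) → f (toℕ c) ≢ f 0 × f (toℕ c) ≢ f 1
  oddCycle-thirdValue _≟_ {suc n} f odd consecutive wrap =
    decidable-stable (Finₚ.any? λ c → ¬? (f (toℕ c) ≟ f 0) ×-dec ¬? (f (toℕ c) ≟ f 1)) λ noThird →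
      wrap (evenPositions noThird (ℕₚ.n<1+n n) (parity-pred n odd))
    where
    Third : Fin (suc n) → Set b
    Third c = f (toℕ c) ≢ f 0 × f (toℕ c) ≢ f 1

    twoValued : ¬ ∃ Third → ∀ {i} → i < suc n → f i ≡ f 0 ⊎ f i ≡ f 1
    twoValued noThird {i} i<n with f i ≟ f 0 | f i ≟ f 1
    ... | yes i≡0 | _       = inj₁ i≡0
    ... | no _    | yes i≡1 = inj₂ i≡1
    ... | no i≢0  | no i≢1  = contradiction
      (Fin.fromℕ< i<n , subst (λ l → f l ≢ f 0 × f l ≢ f 1) (sym (Finₚ.toℕ-fromℕ< i<n)) (i≢0 , i≢1)) noThird

    evenPositions : ¬ ∃ Third → ∀ {i} → i < suc n → parity i ≡ 0ℙ → f i ≡ f 0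
    evenPositions noThird {zero}        _     _    = refl
    evenPositions noThird {suc (suc i)} i+2<n even = trans (sym period2) (evenPositions noThird i<n even)
      where
      i+1<n : suc i < suc n
      i+1<n = ℕₚ.<-trans (ℕₚ.n<1+n (suc i)) i+2<n
      i<n : i < suc n
      i<n = ℕₚ.<-trans (ℕₚ.n<1+n i) i+1<n
      period2 : f i ≡ f (suc (suc i))
      period2 = twoValued-alternates (twoValued noThird i<n) (twoValued noThird i+1<n) (twoValued noThird i+2<n)
                                     (consecutive i+1<n) (consecutive i+2<n)

ProperColouring : ∀ {a ℓ} {A : Set a} → Rel A ℓ → ∀ {n} → (Fin n → A) → (Fin n → Parity) → Set ℓ
ProperColouring R E c = ∀ u v → R (E u) (E v) → c u ≢ c v

module Walks {a ℓ} {A : Set a} (R : Rel A ℓ) where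

  infixr 5 _∷_ _++_
  infixl 5 _∷ʳ_

  data Walk : A → A → ℕ → Set (a ⊔ ℓ) where
    []  : ∀ {x} → Walk x x 0
    _∷_ : ∀ {x y z n} → R x y → Walk y z n → Walk x z (suc n)

  private variable
    x y z : A
    i j n : ℕ

  _++_ : Walk x y i → Walk y z j → Walk x z (i + j)
  []      ++ V = V
  (r ∷ W) ++ V = r ∷ (W ++ V)

  _∷ʳ_ : Walk x y n → R y z → Walk x z (suc n)
  []      ∷ʳ r = r ∷ []
  (s ∷ W) ∷ʳ r = s ∷ (W ∷ʳ r)

  -- the vertex at position i, and the end vertex for i past the end
  _‼_ : Walk x y n → ℕ → A
  _‼_ {x = x} _  zero    = x
  _‼_ {x = x} [] (suc _) = x
  (_ ∷ W) ‼ suc i = W ‼ i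

  ‼-end : (W : Walk x y n) → W ‼ n ≡ y
  ‼-end []      = refl
  ‼-end (_ ∷ W) = ‼-end W

  take : (W : Walk x y n) → i ≤ n → Walk x (W ‼ i) i
  take W       z≤n       = []
  take (r ∷ W) (s≤s i≤n) = r ∷ take W i≤n

  drop : (W : Walk x y n) → i ≤ n → Walk (W ‼ i) y (n ∸ i)
  drop W       z≤n       = W
  drop (_ ∷ W) (s≤s i≤n) = drop W i≤n

  segment : (W : Walk x y n) → i ≤ j → j ≤ n → Walk (W ‼ i) (W ‼ j) (j ∸ i)
  segment W       z≤n       j≤n       = take W j≤n
  segment (_ ∷ W) (s≤s i≤j) (s≤s j≤n) = segment W i≤j j≤n

  Repetition : Walk x y n → Set a
  Repetition {n = n} W = ∃₂ λ i j → i < j × j < n × W ‼ i ≡ W ‼ j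

  Distinct : Walk x y n → Set a
  Distinct {n = n} W = ∀ {i j} → i < n → j < n → W ‼ i ≡ W ‼ j → i ≡ j

  noRepetition⇒distinct : (W : Walk x y n) → ¬ Repetition W → Distinct W
  noRepetition⇒distinct W none {i} {j} i<n j<n same with ℕₚ.<-cmp i j
  ... | tri< i<j _ _ = contradiction (i , j , i<j , j<n , same) none
  ... | tri≈ _ i≡j _ = i≡j
  ... | tri> _ _ j<i = contradiction (j , i , j<i , i<n , sym same) none

  ClosedWalk : ℕ → Set (a ⊔ ℓ)
  ClosedWalk n = ∃[ x ] Walk x x n

  -- Cutting out the loop between the two visits leaves two closed walks whose lengths add up to n.
  shorterOddClosedWalk : (W : Walk x x n) → parity n ≡ 1ℙ → i < j → j < n → W ‼ i ≡ W ‼ j →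
                         ∃[ l ] l < n × parity l ≡ 1ℙ × ClosedWalk l
  shorterOddClosedWalk {x = x} {n = n} {i = i} {j = j} W odd i<j j<n repeat =
    [ (λ loopOdd → j ∸ i , loop<n , loopOdd , _ , loop)
    , (λ restOdd → i + (n ∸ j) , rest<n , restOdd , _ , rest)
    ]′ (parity-+-odd (j ∸ i) (i + (n ∸ j)) (subst (λ l → parity l ≡ 1ℙ) (sym lengths) odd))
    where
    i≤j : i ≤ j
    i≤j = ℕₚ.<⇒≤ i<j
    j≤n : j ≤ n
    j≤n = ℕₚ.<⇒≤ j<n

    loop : Walk (W ‼ i) (W ‼ i) (j ∸ i)
    loop = subst (λ v → Walk (W ‼ i) v (j ∸ i)) (sym repeat) (segment W i≤j j≤n)

    rest : Walk x x (i + (n ∸ j))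
    rest = take W (ℕₚ.≤-trans i≤j j≤n) ++ subst (λ v → Walk v x (n ∸ j)) (sym repeat) (drop W j≤n)

    lengths : (j ∸ i) + (i + (n ∸ j)) ≡ n
    lengths = begin
      (j ∸ i) + (i + (n ∸ j)) ≡⟨ ℕₚ.+-assoc (j ∸ i) i (n ∸ j) ⟨
      (j ∸ i) + i + (n ∸ j)   ≡⟨ cong (_+ (n ∸ j)) (ℕₚ.m∸n+n≡m i≤j) ⟩
      j + (n ∸ j)             ≡⟨ ℕₚ.m+[n∸m]≡n j≤n ⟩
      n                       ∎

    loop<n : j ∸ i < n
    loop<n = subst (j ∸ i <_) lengths
               (ℕₚ.m<m+n (j ∸ i) (ℕₚ.≤-trans (ℕₚ.m<n⇒0<n∸m j<n) (ℕₚ.m≤n+m (n ∸ j) i)))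

    rest<n : i + (n ∸ j) < n
    rest<n = subst (i + (n ∸ j) <_) lengths (ℕₚ.m<n+m (i + (n ∸ j)) (ℕₚ.m<n⇒0<n∸m i<j))

  evenCycles⇒evenClosedWalks : (∀ {x n} (W : Walk x x n) → Distinct W → parity n ≢ 1ℙ) →
                               (W : Walk x x n) → parity n ≢ 1ℙ
  evenCycles⇒evenClosedWalks evenCycle W = go (<-wellFounded _) W
    where
    go : ∀ {x n} → Acc _<_ n → (W : Walk x x n) → parity n ≢ 1ℙ
    go (acc shorter) W odd = ¬¬-excluded-middle {A = Repetition W} λ where
      (yes (i , j , i<j , j<n , repeat)) →
        let l , l<n , oddL , _ , V = shorterOddClosedWalk W odd i<j j<n repeat in go (shorter l<n) V oddL
      (no none) → evenCycle W (noRepetition⇒distinct W none) odd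

  module _ (R-sym : Symmetric R) where

    reverse : Walk x y n → Walk y x n
    reverse []      = []
    reverse (r ∷ W) = reverse W ∷ʳ R-sym r

    module _ (evenClosedWalk : ∀ {x n} (W : Walk x x n) → parity n ≢ 1ℙ) where

      adjacentEnds⇒parity-≢ : Walk x y i → Walk x z j → R y z → parity i ≢ parity j
      adjacentEnds⇒parity-≢ {i = i} {j = j} V W r same =
        evenClosedWalk (V ++ r ∷ reverse W) (parity-+-suc i j same)

      properTwoColouring : ∀ {n} (E : Fin n → A) → ¬ ¬ ∃ (ProperColouring R E)
      properTwoColouring {n} E = ¬¬-map colouring (¬¬-∀ λ v → ¬¬-∀ λ u → ¬¬-excluded-middle)
        where
        Reachable : Fin n → Fin n → Set (a ⊔ ℓ)
        Reachable u v = ∃[ l ] Walk (E u) (E v) l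

        colouring : (∀ v u → Dec (Reachable u v)) → ∃ (ProperColouring R E)
        colouring reachable? = c , proper
          where
          -- v is coloured by the parity of a walk to it from the least vertex of its component.
          fromRoot : ∀ v → ∃ λ u → Reachable u v
          fromRoot v = least (λ u → reachable? v u) (v , 0 , [])

          root : Fin n → Fin n
          root v = proj₁ (fromRoot v)

          distance : Fin n → ℕ
          distance v = proj₁ (proj₂ (fromRoot v))

          path : ∀ v → Walk (E (root v)) (E v) (distance v)
          path v = proj₂ (proj₂ (fromRoot v))

          c : Fin n → Parity
          c v = parity (distance v)

          sameRoot : ∀ {v w} → R (E v) (E w) → root v ≡ root w
          sameRoot r = least-cong _ _ _ _ (λ _ (l , W) → suc l , W ∷ʳ r) (λ _ (l , W) → suc l , W ∷ʳ R-sym r)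

          proper : ProperColouring R E c
          proper v w r = adjacentEnds⇒parity-≢ (path v)
            (subst (λ u → Walk (E u) (E w) (distance w)) (sym (sameRoot r)) (path w)) r

module _ {n : ℕ} where
  open Subsetₚ using (∩-comm; ∪-comm; ∩-abs-∪; ∩-distribˡ-∪; ∩-idem; ∪-identityˡ)

  private variable
    e S T T′ : Subset n

  twoPartition-sym : TwoPartition e S T → TwoPartition e T S
  twoPartition-sym {S = S} {T = T} (S≢∅ , T≢∅ , S∩T≡∅ , S∪T≡e) =
    T≢∅ , S≢∅ , trans (∩-comm T S) S∩T≡∅ , trans (∪-comm T S) S∪T≡e

  twoPartition-irrefl : ¬ TwoPartition e S S
  twoPartition-irrefl {S = S} ((v , v∈S) , _ , S∩S≡∅ , _) =
    Subsetₚ.∉⊥ (subst (v ∈ₛ_) (trans (sym (∩-idem S)) S∩S≡∅) v∈S)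

  complement-⊆ : S ∩ T ≡ ∅ → S ∪ T ≡ S ∪ T′ → T ≡ T ∩ T′
  complement-⊆ {S} {T} {T′} S∩T≡∅ S∪T≡S∪T′ = begin
    T                   ≡⟨ ∩-abs-∪ T S ⟨
    T ∩ (T ∪ S)         ≡⟨ cong (T ∩_) (trans (∪-comm T S) S∪T≡S∪T′) ⟩
    T ∩ (S ∪ T′)        ≡⟨ ∩-distribˡ-∪ T S T′ ⟩
    (T ∩ S) ∪ (T ∩ T′)  ≡⟨ cong (_∪ (T ∩ T′)) (trans (∩-comm T S) S∩T≡∅) ⟩
    ∅ ∪ (T ∩ T′)        ≡⟨ ∪-identityˡ (T ∩ T′) ⟩
    T ∩ T′              ∎

  twoPartition-complement : TwoPartition e S T → TwoPartition e S T′ → T ≡ T′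
  twoPartition-complement {T = T} {T′ = T′} (_ , _ , S∩T≡∅ , S∪T≡e) (_ , _ , S∩T′≡∅ , S∪T′≡e) = begin
    T       ≡⟨ complement-⊆ S∩T≡∅ (trans S∪T≡e (sym S∪T′≡e)) ⟩
    T ∩ T′  ≡⟨ ∩-comm T T′ ⟩
    T′ ∩ T  ≡⟨ complement-⊆ S∩T′≡∅ (trans S∪T′≡e (sym S∪T≡e)) ⟨
    T′      ∎

module _ (H : Hypergraph) where
  open Walks (Sim H)

  private variable
    x y S : Sub H
    i n : ℕ

  Sim-sym : Symmetric (Sim H)
  Sim-sym = Any.map twoPartition-sym

  Sim-irrefl : ¬ Sim H S S
  Sim-irrefl = twoPartition-irrefl ∘ proj₂ ∘ Any.satisfied

  edgeAt : Walk x y n → ℕ → Sub H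
  edgeAt []      _       = ∅
  edgeAt (s ∷ _) zero    = proj₁ (find s)
  edgeAt (_ ∷ W) (suc i) = edgeAt W i

  edgeAt-spec : (W : Walk x y n) → i < n →
                edgeAt W i ∈ edges H × TwoPartition (edgeAt W i) (W ‼ i) (W ‼ suc i)
  edgeAt-spec {i = zero}  (s ∷ W) _         = proj₂ (find s)
  edgeAt-spec {i = suc i} (_ ∷ W) (s≤s i<n) = edgeAt-spec W i<n

  repeatedEdge⇒backtrack : (W : Walk x y n) → suc i < n → edgeAt W i ≡ edgeAt W (suc i) →
                           W ‼ i ≡ W ‼ suc (suc i)
  repeatedEdge⇒backtrack {i = i} W i+1<n same = twoPartition-complement (twoPartition-sym first) second
    where
    first : TwoPartition (edgeAt W i) (W ‼ i) (W ‼ suc i)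
    first = proj₂ (edgeAt-spec W (ℕₚ.<-trans (ℕₚ.n<1+n i) i+1<n))
    second : TwoPartition (edgeAt W i) (W ‼ suc i) (W ‼ suc (suc i))
    second = subst (λ e → TwoPartition e (W ‼ suc i) (W ‼ suc (suc i))) (sym same) (proj₂ (edgeAt-spec W i+1<n))

  toExactWalk : Walk x y n → ExactWalk H
  toExactWalk {n = n} W = record
    { len   = n
    ; part  = λ i → W ‼ toℕ i
    ; edge  = λ i → edgeAt W (toℕ i)
    ; edge∈ = λ i → proj₁ (edgeAt-spec W (Finₚ.toℕ<n i))
    ; step  = λ i → subst (λ l → TwoPartition (edgeAt W (toℕ i)) (W ‼ l) (W ‼ suc (toℕ i)))
                          (sym (Finₚ.toℕ-inject₁ i)) (proj₂ (edgeAt-spec W (Finₚ.toℕ<n i)))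
    }

  oddCycle⇒oddExactCycle : (W : Walk S S n) → Distinct W → parity n ≡ 1ℙ → HasOddExactCycle H
  oddCycle⇒oddExactCycle (s ∷ []) _ _ = ⊥-elim (Sim-irrefl s)
  oddCycle⇒oddExactCycle {n = n@(suc (suc (suc l)))} W distinct odd =
    toExactWalk W , (threeEdges , closed , internal) , parity⇒Odd n odd
    where
    consecutive : ∀ {i} → suc i < n → edgeAt W i ≢ edgeAt W (suc i)
    consecutive {i} i+1<n same with ℕₚ.m≤n⇒m<n∨m≡n i+1<n
    ... | inj₁ i+2<n = ℕₚ.<⇒≢ (ℕₚ.m<n⇒m<1+n (ℕₚ.n<1+n i))
                         (distinct (ℕₚ.<-trans (ℕₚ.n<1+n i) i+1<n) i+2<n (repeatedEdge⇒backtrack W i+1<n same))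
    ... | inj₂ refl  = contradiction
      (distinct (ℕₚ.m<n⇒m<1+n (ℕₚ.n<1+n (suc l))) (s≤s z≤n) (trans (repeatedEdge⇒backtrack W i+1<n same) (‼-end W)))
      λ ()

    wrap : edgeAt W (pred n) ≢ edgeAt W 0
    wrap same = contradiction (distinct (ℕₚ.n<1+n (suc (suc l))) (s≤s (s≤s z≤n)) (twoPartition-complement last first)) λ ()
      where
      last : TwoPartition (edgeAt W 0) (W ‼ 0) (W ‼ suc (suc l))
      last = subst (λ e → TwoPartition e (W ‼ 0) (W ‼ suc (suc l))) same (twoPartition-sym
               (subst (TwoPartition _ _) (‼-end W) (proj₂ (edgeAt-spec W (ℕₚ.n<1+n (suc (suc l)))))))
      first : TwoPartition (edgeAt W 0) (W ‼ 0) (W ‼ 1)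
      first = proj₂ (edgeAt-spec W (s≤s z≤n))

    threeEdges : ∃ λ (a : Fin n) → ∃ λ (b : Fin n) → ∃ λ (c : Fin n) →
                   edgeAt W (toℕ a) ≢ edgeAt W (toℕ b) × edgeAt W (toℕ a) ≢ edgeAt W (toℕ c) ×
                   edgeAt W (toℕ b) ≢ edgeAt W (toℕ c)
    threeEdges = let c , c≢0 , c≢1 = oddCycle-thirdValue (≡-dec Boolₚ._≟_) (edgeAt W) odd consecutive wrap
                 in zero , suc zero , c , consecutive (s≤s (s≤s z≤n)) , ≢-sym c≢0 , ≢-sym c≢1

    closed : W ‼ 0 ≡ W ‼ toℕ (fromℕ n)
    closed = sym (trans (cong (W ‼_) (Finₚ.toℕ-fromℕ n)) (‼-end W))

    internal : ∀ (i j : Fin (suc n)) → 0 < toℕ i → toℕ i < n → 0 < toℕ j → toℕ j < n →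
               W ‼ toℕ i ≡ W ‼ toℕ j → i ≡ j
    internal i j _ i<n _ j<n same = Finₚ.toℕ-injective (distinct i<n j<n same)

  noOddExactCycle⇒evenClosedWalks : ¬ HasOddExactCycle H → (W : Walk S S n) → parity n ≢ 1ℙ
  noOddExactCycle⇒evenClosedWalks noOdd =
    evenCycles⇒evenClosedWalks λ W distinct odd → noOdd (oddCycle⇒oddExactCycle W distinct odd)

signOf : Parity → ℤ
signOf 0ℙ = 1ℤ
signOf 1ℙ = -1ℤ

signOf-square : ∀ p → signOf p * signOf p ≡ 1ℤ
signOf-square 0ℙ = refl
signOf-square 1ℙ = refl

signOf-≢ : ∀ {p q} → p ≢ q → signOf p * signOf q ≡ -1ℤ
signOf-≢ {0ℙ} {0ℙ} p≢q = contradiction refl p≢q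
signOf-≢ {0ℙ} {1ℙ} _   = refl
signOf-≢ {1ℙ} {0ℙ} _   = refl
signOf-≢ {1ℙ} {1ℙ} p≢q = contradiction refl p≢q

UQ-signConjugate-UL : ∀ H (ε : Enumeration H) (c : Fin (m ε) → Parity) → ProperColouring (Sim H) (elt ε) c →
                      ∀ i j → UQ H ε i j ≡ signOf (c i) * signOf (c j) * UL H ε i j
UQ-signConjugate-UL H ε c proper i j with i ≟ᶠ j | sim? H (elt ε i) (elt ε j)
... | yes refl | yes s = contradiction s (Sim-irrefl H)
... | yes refl | no _  = sym (trans (cong (_* _) (signOf-square (c i))) (ℤₚ.*-identityˡ _))
... | no _     | yes s rewrite signOf-≢ (proper i j s) = refl
... | no _     | no _  = sym (ℤₚ.*-zeroʳ (signOf (c i) * signOf (c j)))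

mainTheorem11 : (H : Hypergraph) → WellFormed H → Simple H →
    ¬ HasOddExactCycle H →
    (ε : Enumeration H) → charPoly (UQ H ε) ≈ₚ charPoly (UL H ε)
mainTheorem11 H _ _ noOdd ε i =
  decidable-stable (coeff (charPoly (UQ H ε)) i ℤ.≟ coeff (charPoly (UL H ε)) i)
    (¬¬-map (cong (λ p → coeff p i) ∘ charPolyEq) twoColouring)
  where
  open Walks (Sim H)

  twoColouring : ¬ ¬ ∃ (ProperColouring (Sim H) (elt ε))
  twoColouring = properTwoColouring (Sim-sym H) (noOddExactCycle⇒evenClosedWalks H noOdd) (elt ε)

  charPolyEq : ∃ (ProperColouring (Sim H) (elt ε)) → charPoly (UQ H ε) ≡ charPoly (UL H ε)
  charPolyEq (c , proper) =
    charPoly-signConjugate (UQ H ε) (UL H ε) (signOf ∘ c) (signOf-square ∘ c) (UQ-signConjugate-UL H ε c proper)
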